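{- Let $n \geq 2$ and let $F_1, \ldots, F_n$ be finite sets of clauses. Run the following procedure on $(F_1,\ldots,F_n)$: 1. Set $V_1 \leftarrow F_1 \setminus F_2$ and $C_1 \leftarrow F_1 \setminus V_1$. 2. For $i = 2, \ldots, n-1$ (in increasing order): set $V_i \leftarrow F_i \setminus F_{i+1}$ and $C_i \leftarrow (F_i \setminus F_{i-1}) \setminus V_i$; then for each clause $c \in V_i \cap F_{i-1}$: for $j = 1, \ldots, i-1$ (in increasing order), if $c \in C_j$, then set $C_j \leftarrow C_j \setminus \{c\}$, set $V_k \leftarrow V_k \cup \{c\}$ for every $k$ with $j \leq k \leq i-1$, and stop the loop over $j$ (proceed to the next clause $c$). 3. Set $C_n \leftarrow F_n \setminus F_{n-1}$ and $V_n \leftarrow \emptyset$. Then the procedure terminates, and on termination, for every $i$ with $1 \leq i \leq n$, $C_i$ is exactly the set of clauses that are cumulative in $F_i$ (with respect to the sequence $(F_1,\ldots,F_n)$) and $V_i$ is exactly the set of clauses that are volatile in $F_i$ (with respect to the sequence $(F_1,\ldots,F_n)$).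
   Context: A clause is a finite disjunction of literals; clause sets are treated as plain finite sets (set operations $\setminus$, $\cap$, $\cup$ are the usual ones). For a sequence $(F_1,\ldots,F_n)$ of clause sets and an index $1 \le i \le n$: a clause $c$ is volatile in $F_i$ if $c \in F_i$ and there exists $j$ with $i < j \leq n$ such that $c \notin F_j$ (i.e. $c$ is removed at some later point). A clause $c$ is cumulative in $F_i$ if $c \in F_i$, $c$ appears in $F_i$ for the first time (i.e. $i = 1$ or $c \notin F_{i-1}$), and $c \in F_j$ for every $j$ with $i < j \leq n$ (i.e. $c$ is never removed afterwards). -}

module Defs where

open import Data.Nat using (ℕ; zero; suc; _∸_; _≤_; _<_; _≤?_)
open import Data.List using (List; []; _∷_; _++_; filter; foldl; deduplicate)
open import Data.Product using (_×_; ∃)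
open import Data.Sum using (_⊎_)
open import Relation.Nullary using (¬_; ¬?; yes; no)
open import Relation.Nullary.Decidable using (_×-dec_)
open import Relation.Binary.Definitions using (DecidableEquality)
open import Relation.Binary.PropositionalEquality using (_≡_)
open import Data.List.Membership.Propositional using (_∈_; _∉_)
import Data.List.Membership.DecPropositional as DecMem

-- Clauses are elements of an arbitrary type with decidable equality;
-- finite clause sets are lists, read as sets via membership _∈_.
-- A sequence (F_1,...,F_n) is F : ℕ → List A, using indices 1..n.

module Proc {A : Set} (_≟_ : DecidableEquality A) where

  open DecMem _≟_ using (_∈?_)

  _∖_ : List A → List A → List A
  xs ∖ ys = filter (λ x → ¬? (x ∈? ys)) xs

  _∩_ : List A → List A → List A
  xs ∩ ys = filter (λ x → x ∈? ys) xs

  _∪_ : List A → List A → List A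
  xs ∪ ys = xs ++ ys

  removeOne : A → List A → List A
  removeOne c xs = filter (λ x → ¬? (x ≟ c)) xs

  record State : Set where
    constructor st
    field
      C : ℕ → List A
      V : ℕ → List A
  open State public

  upd : (ℕ → List A) → ℕ → List A → ℕ → List A
  upd f k v m with m Data.Nat.≟ k
  ... | yes _ = v
  ... | no  _ = f m

  addV : A → (j i : ℕ) → (ℕ → List A) → ℕ → List A
  addV c j i f k with (j ≤? k) ×-dec (k ≤? (i ∸ 1))
  ... | yes _ = f k ∪ (c ∷ [])
  ... | no  _ = f k

  -- inner loop over j = j₀, j₀+1, ... (fuel = number of remaining j's)
  jloop : A → (i j fuel : ℕ) → State → State
  jloop c i j zero s = s
  jloop c i j (suc m) s with c ∈? C s j
  ... | yes _ = st (upd (C s) j (removeOne c (C s j))) (addV c j i (V s))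
  ... | no  _ = jloop c i (suc j) m s

  processClause : ℕ → State → A → State
  processClause i s c = jloop c i 1 (i ∸ 1) s

  step2 : (ℕ → List A) → ℕ → State → State
  step2 F i s =
    let Vi = F i ∖ F (suc i)
        Ci = (F i ∖ F (i ∸ 1)) ∖ Vi
        s' = st (upd (C s) i Ci) (upd (V s) i Vi)
    in foldl (processClause i) s' (deduplicate _≟_ (Vi ∩ F (i ∸ 1)))

  outer : (ℕ → List A) → (i fuel : ℕ) → State → State
  outer F i zero s = s
  outer F i (suc m) s = outer F (suc i) m (step2 F i s)

  procedure : (n : ℕ) → (ℕ → List A) → State
  procedure n F =
    let V1 = F 1 ∖ F 2
        C1 = F 1 ∖ V1
        s1 = st (upd (λ _ → []) 1 C1) (upd (λ _ → []) 1 V1)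
        s2 = outer F 2 (n ∸ 2) s1
    in st (upd (C s2) n (F n ∖ F (n ∸ 1))) (upd (V s2) n [])

Volatile : {A : Set} → (n : ℕ) → (ℕ → List A) → ℕ → A → Set
Volatile n F i c = c ∈ F i × ∃ λ j → i < j × j ≤ n × c ∉ F j

Cumulative : {A : Set} → (n : ℕ) → (ℕ → List A) → ℕ → A → Set
Cumulative n F i c =
  c ∈ F i × (i ≡ 1 ⊎ c ∉ F (i ∸ 1)) × (∀ j → i < j → j ≤ n → c ∈ F j)

module Submission where

-- After iteration i of step 2 (and after step 1 for i = 1) the
-- state records, at every index k ≤ i, exactly the cumulative and the
-- volatile clauses of F_k with respect to the PREFIX (F_1,...,F_{i+1}).
-- Passing from the prefix of length p+1 to that of length p+2 (i = p+1)
-- changes the status of a clause d at an index k ≤ p only if d is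
-- "dropped at p": d ∈ F_p, d ∈ F_{p+1}, d ∉ F_{p+2}.  Such a d stops
-- being cumulative anywhere and becomes volatile wherever it occurs; the
-- inner loop achieves exactly this, because d is cumulative at exactly
-- one index k₀ ≤ p (the start of its last run), the loop finds d in
-- C_{k₀}, removes it there and adds it to V_{k₀},...,V_p, while at the
-- indices before k₀ where d occurs it was already volatile.

open import Defs
open import Data.Nat using (ℕ; zero; suc; _+_; _∸_; _≤_; _<_; _≤?_; z≤n; s≤s)
import Data.Nat as ℕ
open import Data.Nat.Properties
  using (≤-refl; ≤-trans; ≤-antisym; ≤-pred; n≤1+n; m≤n⇒m≤1+n; <⇒≱; <⇒≤; ≤∧≢⇒<;
         m≤n⇒m<n∨m≡n; m<1+n⇒m≤n; <-cmp; ≰⇒>; +-suc; +-identityʳ; m<m+n)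
open import Data.List using (List; []; _∷_; foldl; deduplicate)
open import Data.List.Membership.Propositional using (_∈_; _∉_)
open import Data.List.Membership.Propositional.Properties
  using (∈-filter⁺; ∈-filter⁻; ∈-++⁺ˡ; ∈-++⁺ʳ; ∈-++⁻; ∈-deduplicate⁺; ∈-deduplicate⁻)
import Data.List.Membership.DecPropositional as DecMembership
open import Data.List.Relation.Unary.Any using (here; there)
open import Data.Product using (_×_; _,_; proj₁; proj₂; ∃)
open import Data.Sum using (_⊎_; inj₁; inj₂)
import Data.Sum as Sum
open import Data.Empty using (⊥; ⊥-elim)
open import Function.Bundles using (_⇔_; mk⇔; Equivalence)
import Function.Properties.Equivalence as ⇔
open import Relation.Nullary using (¬_; ¬?; yes; no)
open import Relation.Nullary.Decidable using (_×-dec_; toSum)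
open import Relation.Binary.Definitions using (DecidableEquality; tri<; tri≈; tri>)
open import Relation.Binary.PropositionalEquality using (_≡_; _≢_; refl; sym; subst)

open Equivalence using (to; from)

≤-suc-cases : ∀ {m n} → m ≤ suc n → m ≤ n ⊎ m ≡ suc n
≤-suc-cases m≤1+n = Sum.map₁ m<1+n⇒m≤n (m≤n⇒m<n∨m≡n m≤1+n)

nothing-after : ∀ {P : ℕ → Set} n j → n < j → j ≤ n → P j
nothing-after n j n<j j≤n = ⊥-elim (<⇒≱ n<j j≤n)

module Sequence {A : Set} (_≟_ : DecidableEquality A) (F : ℕ → List A) where
  open DecMembership _≟_ using (_∈?_)

  cumulative-persists : ∀ {n k j d} → Cumulative n F k d → k ≤ j → j ≤ n → d ∈ F j
  cumulative-persists {k = k} {j} (d∈Fk , _ , later) k≤j j≤n with k ℕ.≟ j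
  ... | yes refl = d∈Fk
  ... | no k≢j = later j (≤∧≢⇒< k≤j k≢j) j≤n

  -- Two cumulative indices a < b are impossible: the first appearance at b
  -- says d ∉ F_{b-1}, while persistence from a gives d ∈ F_{b-1}.
  cumulative-unique-< : ∀ {n a b d} → 1 ≤ a → a < b → b ≤ n →
                        Cumulative n F a d → Cumulative n F b d → ⊥
  cumulative-unique-< {b = suc b} 1≤a (s≤s a≤b) _ _ (_ , inj₁ refl , _) = <⇒≱ (s≤s a≤b) 1≤a
  cumulative-unique-< {b = suc b} 1≤a (s≤s a≤b) b≤n cum-a (_ , inj₂ d∉Fb , _) =
    d∉Fb (cumulative-persists cum-a a≤b (≤-trans (n≤1+n b) b≤n))

  cumulative-unique : ∀ {n a b d} → 1 ≤ a → 1 ≤ b → a ≤ n → b ≤ n →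
                      Cumulative n F a d → Cumulative n F b d → a ≡ b
  cumulative-unique {a = a} {b} 1≤a 1≤b a≤n b≤n cum-a cum-b with <-cmp a b
  ... | tri< a<b _ _ = ⊥-elim (cumulative-unique-< 1≤a a<b b≤n cum-a cum-b)
  ... | tri≈ _ a≡b _ = a≡b
  ... | tri> _ _ b<a = ⊥-elim (cumulative-unique-< 1≤b b<a a≤n cum-b cum-a)

  cumulative-extend : ∀ {n k d} → Cumulative n F k d → d ∈ F (suc n) →
                      Cumulative (suc n) F k d
  cumulative-extend {n} {k} {d} (d∈Fk , first , later) d∈Fn+1 = d∈Fk , first , later′
    where
    later′ : ∀ j → k < j → j ≤ suc n → d ∈ F j
    later′ j k<j j≤n+1 with ≤-suc-cases j≤n+1
    ... | inj₁ j≤n = later j k<j j≤n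
    ... | inj₂ refl = d∈Fn+1

  -- Every clause of F_{m+1} is cumulative at the start of its last run.
  cumulative-start : ∀ m {d} → d ∈ F (suc m) →
                     ∃ λ k → 1 ≤ k × k ≤ suc m × Cumulative (suc m) F k d
  cumulative-start zero d∈F1 = 1 , ≤-refl , ≤-refl , d∈F1 , inj₁ refl , nothing-after 1
  cumulative-start (suc m) {d} d∈F with d ∈? F (suc m)
  ... | no d∉ = suc (suc m) , s≤s z≤n , ≤-refl , d∈F , inj₂ d∉ , nothing-after (suc (suc m))
  ... | yes d∈ with cumulative-start m d∈
  ...   | k , 1≤k , k≤ , cum = k , 1≤k , m≤n⇒m≤1+n k≤ , cumulative-extend cum d∈F

  volatile-extend : ∀ {n k d} → Volatile n F k d → Volatile (suc n) F k d
  volatile-extend (d∈Fk , j , k<j , j≤n , d∉Fj) = d∈Fk , j , k<j , m≤n⇒m≤1+n j≤n , d∉Fj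

  -- A clause present at k, but absent just before a later index k₀ ≤ n,
  -- is volatile at k (it is removed at k₀ - 1 at the latest).
  volatile-before-gap : ∀ {n k k₀ d} → k < k₀ → k₀ ≤ n → d ∉ F (k₀ ∸ 1) → d ∈ F k →
                        Volatile n F k d
  volatile-before-gap {k = k} {suc k₀} (s≤s k≤k₀) k₀≤n d∉ d∈ with k ℕ.≟ k₀
  ... | yes refl = ⊥-elim (d∉ d∈)
  ... | no k≢k₀ = d∈ , k₀ , ≤∧≢⇒< k≤k₀ k≢k₀ , ≤-trans (n≤1+n k₀) k₀≤n , d∉

  volatile-last : ∀ {i d} → Volatile (suc i) F i d ⇔ (d ∈ F i × d ∉ F (suc i))
  volatile-last {i} {d} = mk⇔
    (λ (d∈ , j , i<j , j≤ , d∉) → d∈ , subst (λ j → d ∉ F j) (≤-antisym j≤ i<j) d∉)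
    (λ (d∈ , d∉) → d∈ , suc i , ≤-refl , ≤-refl , d∉)

  cumulative-last : ∀ {i d} →
    Cumulative (suc i) F i d ⇔ (d ∈ F i × (i ≡ 1 ⊎ d ∉ F (i ∸ 1)) × d ∈ F (suc i))
  cumulative-last {i} {d} = mk⇔
    (λ (d∈ , first , later) → d∈ , first , later (suc i) ≤-refl ≤-refl)
    (λ (d∈ , first , d∈′) → d∈ , first ,
       λ j i<j j≤ → subst (λ j → d ∈ F j) (sym (≤-antisym j≤ i<j)) d∈′)

  Dropped : ℕ → A → Set
  Dropped p d = d ∈ F p × d ∈ F (suc p) × d ∉ F (suc (suc p))

  dropped-not-cumulative : ∀ {p k d} → Dropped p d → k ≤ suc p →
                           ¬ Cumulative (suc (suc p)) F k d
  dropped-not-cumulative (_ , _ , d∉) k≤ cum = d∉ (cumulative-persists cum (m≤n⇒m≤1+n k≤) ≤-refl)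

  dropped-volatile : ∀ {p k d} → Dropped p d → k ≤ suc p →
                     Volatile (suc (suc p)) F k d ⇔ d ∈ F k
  dropped-volatile {p} (_ , _ , d∉) k≤ = mk⇔ proj₁ (λ d∈ → d∈ , suc (suc p) , s≤s k≤ , ≤-refl , d∉)

  undropped-cumulative : ∀ {p k d} → ¬ Dropped p d → k ≤ p →
    Cumulative (suc p) F k d ⇔ Cumulative (suc (suc p)) F k d
  undropped-cumulative {p} {k} {d} ¬dropped k≤p = mk⇔ extend
    (λ (d∈ , first , later) → d∈ , first , λ j k<j j≤ → later j k<j (m≤n⇒m≤1+n j≤))
    where
    extend : Cumulative (suc p) F k d → Cumulative (suc (suc p)) F k d
    extend cum with d ∈? F (suc (suc p))
    ... | yes d∈ = cumulative-extend cum d∈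
    ... | no d∉ = ⊥-elim (¬dropped ( cumulative-persists cum k≤p (n≤1+n p)
                                   , cumulative-persists cum (m≤n⇒m≤1+n k≤p) ≤-refl , d∉))

  undropped-volatile : ∀ {p k d} → ¬ Dropped p d → k ≤ p →
    Volatile (suc p) F k d ⇔ Volatile (suc (suc p)) F k d
  undropped-volatile {p} {k} {d} ¬dropped k≤p = mk⇔ volatile-extend restrict
    where
    restrict : Volatile (suc (suc p)) F k d → Volatile (suc p) F k d
    restrict (d∈ , j , k<j , j≤ , d∉Fj) with ≤-suc-cases j≤
    ... | inj₁ j≤p+1 = d∈ , j , k<j , j≤p+1 , d∉Fj
    ... | inj₂ refl with d ∈? F (suc p) | d ∈? F p
    ...   | no d∉ | _ = d∈ , suc p , s≤s k≤p , ≤-refl , d∉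
    ...   | yes d∈′ | yes d∈″ = ⊥-elim (¬dropped (d∈″ , d∈′ , d∉Fj))
    ...   | yes _ | no d∉ = volatile-before-gap (s≤s k≤p) ≤-refl d∉ d∈

module ListSets {A : Set} (_≟_ : DecidableEquality A) where
  open Proc _≟_
  open DecMembership _≟_ using (_∈?_)

  ∈-∖ : ∀ {d} xs ys → d ∈ xs ∖ ys ⇔ (d ∈ xs × d ∉ ys)
  ∈-∖ xs ys = mk⇔ (∈-filter⁻ (λ x → ¬? (x ∈? ys))) (λ (d∈ , d∉) → ∈-filter⁺ (λ x → ¬? (x ∈? ys)) d∈ d∉)

  ∉-∖ : ∀ {d} xs ys → d ∈ xs → d ∉ xs ∖ ys → d ∈ ys
  ∉-∖ {d} xs ys d∈xs d∉ with d ∈? ys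
  ... | yes d∈ys = d∈ys
  ... | no d∉ys = ⊥-elim (d∉ (from (∈-∖ xs ys) (d∈xs , d∉ys)))

  ∈-∩ : ∀ {d} xs ys → d ∈ xs ∩ ys ⇔ (d ∈ xs × d ∈ ys)
  ∈-∩ xs ys = mk⇔ (∈-filter⁻ (λ x → x ∈? ys)) (λ (d∈xs , d∈ys) → ∈-filter⁺ (λ x → x ∈? ys) d∈xs d∈ys)

  ∈-removeOne : ∀ {d} c xs → d ∈ removeOne c xs ⇔ (d ∈ xs × d ≢ c)
  ∈-removeOne c xs = mk⇔ (∈-filter⁻ (λ x → ¬? (x ≟ c))) (λ (d∈ , d≢c) → ∈-filter⁺ (λ x → ¬? (x ≟ c)) d∈ d≢c)

  ∈-∪-singleton : ∀ {d c} xs → d ∈ xs ∪ (c ∷ []) ⇔ (d ∈ xs ⊎ d ≡ c)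
  ∈-∪-singleton xs = mk⇔ split (Sum.[ ∈-++⁺ˡ , (λ d≡c → ∈-++⁺ʳ xs (here d≡c)) ])
    where
    split : ∀ {d c} → d ∈ xs ∪ (c ∷ []) → d ∈ xs ⊎ d ≡ c
    split d∈ with ∈-++⁻ xs d∈
    ... | inj₁ d∈xs = inj₁ d∈xs
    ... | inj₂ (here d≡c) = inj₂ d≡c

module Updates {A : Set} (_≟_ : DecidableEquality A) where
  open Proc _≟_
  open ListSets _≟_
  open DecMembership _≟_ using (_∈?_)

  ∈-upd-here : ∀ {d} f k v → d ∈ upd f k v k ⇔ d ∈ v
  ∈-upd-here f k v with k ℕ.≟ k
  ... | yes _ = ⇔.refl
  ... | no k≢k = ⊥-elim (k≢k refl)

  ∈-upd-elsewhere : ∀ {d} f k v m → m ≢ k → d ∈ upd f k v m ⇔ d ∈ f m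
  ∈-upd-elsewhere f k v m m≢k with m ℕ.≟ k
  ... | yes m≡k = ⊥-elim (m≢k m≡k)
  ... | no _ = ⇔.refl

  ∈-addV-inside : ∀ {d} c j i f k → j ≤ k → k ≤ i ∸ 1 → d ∈ addV c j i f k ⇔ (d ∈ f k ⊎ d ≡ c)
  ∈-addV-inside c j i f k j≤k k≤ with (j ≤? k) ×-dec (k ≤? (i ∸ 1))
  ... | yes _ = ∈-∪-singleton (f k)
  ... | no out = ⊥-elim (out (j≤k , k≤))

  ∈-addV-outside : ∀ {d} c j i f k → ¬ (j ≤ k × k ≤ i ∸ 1) → d ∈ addV c j i f k ⇔ d ∈ f k
  ∈-addV-outside c j i f k out with (j ≤? k) ×-dec (k ≤? (i ∸ 1))
  ... | yes inside = ⊥-elim (out inside)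
  ... | no _ = ⇔.refl

  found : A → ℕ → ℕ → State → State
  found c i k s = st (upd (C s) k (removeOne c (C s k))) (addV c k i (V s))

  data Outcome (c : A) (i j fuel : ℕ) (s : State) : State → Set where
    missed   : (∀ k → j ≤ k → k < j + fuel → c ∉ C s k) → Outcome c i j fuel s s
    found-at : ∀ k → j ≤ k → k < j + fuel → c ∈ C s k → Outcome c i j fuel s (found c i k s)

  jloop-outcome : ∀ c i j fuel s → Outcome c i j fuel s (jloop c i j fuel s)
  jloop-outcome c i j zero s =
    missed (λ k j≤k k<j+0 → ⊥-elim (<⇒≱ (subst (k <_) (+-identityʳ j) k<j+0) j≤k))
  jloop-outcome c i j (suc m) s with c ∈? C s j
  ... | yes c∈ = found-at j ≤-refl (m<m+n j (s≤s z≤n)) c∈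
  ... | no c∉ with jloop c i (suc j) m s | jloop-outcome c i (suc j) m s
  ...   | _ | missed none = missed none′
    where
    none′ : ∀ k → j ≤ k → k < j + suc m → c ∉ C s k
    none′ k j≤k k< with j ℕ.≟ k
    ... | yes refl = c∉
    ... | no j≢k = none k (≤∧≢⇒< j≤k j≢k) (subst (k <_) (+-suc j m) k<)
  ...   | _ | found-at k j<k k< c∈ = found-at k (<⇒≤ j<k) (subst (k <_) (sym (+-suc j m)) k<) c∈

  Same : State → State → A → Set
  Same s t d = ∀ k → (d ∈ C s k ⇔ d ∈ C t k) × (d ∈ V s k ⇔ d ∈ V t k)

  same-refl : ∀ {s d} → Same s s d
  same-refl k = ⇔.refl , ⇔.refl

  same-trans : ∀ {s t u d} → Same s t d → Same t u d → Same s u d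
  same-trans s~t t~u k = ⇔.trans (proj₁ (s~t k)) (proj₁ (t~u k)) , ⇔.trans (proj₂ (s~t k)) (proj₂ (t~u k))

  found-other : ∀ {d} c i k s → d ≢ c → Same (found c i k s) s d
  found-other {d} c i k s d≢c k′ = C-part , V-part
    where
    C-part : d ∈ upd (C s) k (removeOne c (C s k)) k′ ⇔ d ∈ C s k′
    C-part with toSum (k′ ℕ.≟ k)
    ... | inj₁ refl = ⇔.trans (∈-upd-here (C s) k′ _)
                       (mk⇔ (λ d∈ → proj₁ (to (∈-removeOne c _) d∈)) (λ d∈ → from (∈-removeOne c _) (d∈ , d≢c)))
    ... | inj₂ k′≢k = ∈-upd-elsewhere (C s) k _ k′ k′≢k
    V-part : d ∈ addV c k i (V s) k′ ⇔ d ∈ V s k′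
    V-part with toSum ((k ≤? k′) ×-dec (k′ ≤? (i ∸ 1)))
    ... | inj₂ out = ∈-addV-outside c k i (V s) k′ out
    ... | inj₁ (k≤k′ , k′≤) = ⇔.trans (∈-addV-inside c k i (V s) k′ k≤k′ k′≤)
                               (mk⇔ Sum.[ (λ d∈ → d∈) , (λ d≡c → ⊥-elim (d≢c d≡c)) ] inj₁)

  jloop-other : ∀ {d} c i j fuel s → d ≢ c → Same (jloop c i j fuel s) s d
  jloop-other c i j fuel s d≢c with jloop c i j fuel s | jloop-outcome c i j fuel s
  ... | _ | missed _ = same-refl
  ... | _ | found-at k _ _ _ = found-other c i k s d≢c

module Correctness {A : Set} (_≟_ : DecidableEquality A) (F : ℕ → List A) where
  open Proc _≟_
  open ListSets _≟_
  open Updates _≟_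
  open Sequence _≟_ F
  open DecMembership _≟_ using (_∈?_)

  Agrees : ℕ → State → A → Set
  Agrees m s d = ∀ k → 1 ≤ k → k ≤ m →
    (d ∈ C s k ⇔ Cumulative (suc m) F k d) × (d ∈ V s k ⇔ Volatile (suc m) F k d)

  Correct : ℕ → State → Set
  Correct m s = ∀ d → Agrees m s d

  agrees-transfer : ∀ {m s t d} → Same s t d → Agrees m t d → Agrees m s d
  agrees-transfer s~t ag k 1≤k k≤m =
    ⇔.trans (proj₁ (s~t k)) (proj₁ (ag k 1≤k k≤m)) , ⇔.trans (proj₂ (s~t k)) (proj₂ (ag k 1≤k k≤m))

  initial : State
  initial = st (upd (λ _ → []) 1 (F 1 ∖ (F 1 ∖ F 2))) (upd (λ _ → []) 1 (F 1 ∖ F 2))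

  initial-correct : Correct 1 initial
  initial-correct d (suc zero) _ _ =
    ⇔.trans (∈-upd-here (λ _ → []) 1 _) (mk⇔ to-cum from-cum) ,
    ⇔.trans (∈-upd-here (λ _ → []) 1 _) (⇔.trans (∈-∖ (F 1) (F 2)) (⇔.sym volatile-last))
    where
    to-cum : d ∈ F 1 ∖ (F 1 ∖ F 2) → Cumulative 2 F 1 d
    to-cum d∈ = let (d∈F1 , d∉V1) = to (∈-∖ (F 1) _) d∈
                in from cumulative-last (d∈F1 , inj₁ refl , ∉-∖ (F 1) (F 2) d∈F1 d∉V1)
    from-cum : Cumulative 2 F 1 d → d ∈ F 1 ∖ (F 1 ∖ F 2)
    from-cum cum = let (d∈F1 , _ , d∈F2) = to cumulative-last cum
                   in from (∈-∖ (F 1) _) (d∈F1 , λ d∈V1 → proj₂ (to (∈-∖ (F 1) (F 2)) d∈V1) d∈F2)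
  initial-correct d (suc (suc _)) _ (s≤s ())

  module Iteration (q : ℕ) (s₀ : State) (s₀-correct : Correct (suc q) s₀) where
    p i : ℕ
    p = suc q
    i = suc p

    Vi Ci : List A
    Vi = F i ∖ F (suc i)
    Ci = (F i ∖ F p) ∖ Vi

    s′ : State
    s′ = st (upd (C s₀) i Ci) (upd (V s₀) i Vi)

    L : List A
    L = deduplicate _≟_ (Vi ∩ F p)

    ∈L⇔dropped : ∀ {d} → d ∈ L ⇔ Dropped p d
    ∈L⇔dropped {d} = mk⇔
      (λ d∈L → let (d∈Vi , d∈Fp) = to (∈-∩ Vi (F p)) (∈-deduplicate⁻ _≟_ (Vi ∩ F p) d∈L)
                   (d∈Fi , d∉Fi+1) = to (∈-∖ (F i) (F (suc i))) d∈Vi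
               in d∈Fp , d∈Fi , d∉Fi+1)
      (λ (d∈Fp , d∈Fi , d∉Fi+1) →
         ∈-deduplicate⁺ _≟_ (from (∈-∩ Vi (F p)) (from (∈-∖ (F i) (F (suc i))) (d∈Fi , d∉Fi+1) , d∈Fp)))

    Ci-correct : ∀ {d} → d ∈ Ci ⇔ Cumulative (suc i) F i d
    Ci-correct {d} = mk⇔
      (λ d∈ → let (d∈Fi∖Fp , d∉Vi) = to (∈-∖ _ Vi) d∈
                  (d∈Fi , d∉Fp) = to (∈-∖ (F i) (F p)) d∈Fi∖Fp
              in from cumulative-last (d∈Fi , inj₂ d∉Fp , ∉-∖ (F i) (F (suc i)) d∈Fi d∉Vi))
      (λ cum → let (d∈Fi , first , d∈Fi+1) = to cumulative-last cum
               in from (∈-∖ _ Vi) ( from (∈-∖ (F i) (F p)) (d∈Fi , first-appearance first)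
                                  , λ d∈Vi → proj₂ (to (∈-∖ (F i) (F (suc i))) d∈Vi) d∈Fi+1))
      where
      first-appearance : i ≡ 1 ⊎ d ∉ F p → d ∉ F p
      first-appearance (inj₂ d∉Fp) = d∉Fp

    Vi-correct : ∀ {d} → d ∈ Vi ⇔ Volatile (suc i) F i d
    Vi-correct = ⇔.trans (∈-∖ (F i) (F (suc i))) (⇔.sym volatile-last)

    below-i : ∀ {k} → k ≤ p → k ≢ i
    below-i k≤p refl = <⇒≱ ≤-refl k≤p

    pending-below : ∀ {s d k} → Same s s′ d → 1 ≤ k → k ≤ p →
      (d ∈ C s k ⇔ Cumulative (suc p) F k d) × (d ∈ V s k ⇔ Volatile (suc p) F k d)
    pending-below {s} {d} {k} s~s′ 1≤k k≤p =
      ⇔.trans (proj₁ (s~s′ k)) (⇔.trans (∈-upd-elsewhere (C s₀) i Ci k (below-i k≤p)) (proj₁ (s₀-correct d k 1≤k k≤p))) ,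
      ⇔.trans (proj₂ (s~s′ k)) (⇔.trans (∈-upd-elsewhere (V s₀) i Vi k (below-i k≤p)) (proj₂ (s₀-correct d k 1≤k k≤p)))

    pending-top : ∀ {s d} → Same s s′ d → (d ∈ C s i ⇔ d ∈ Ci) × (d ∈ V s i ⇔ d ∈ Vi)
    pending-top s~s′ = ⇔.trans (proj₁ (s~s′ i)) (∈-upd-here (C s₀) i Ci) ,
                       ⇔.trans (proj₂ (s~s′ i)) (∈-upd-here (V s₀) i Vi)

    undropped-agrees : ∀ {d} → ¬ Dropped p d → Agrees i s′ d
    undropped-agrees {d} ¬dropped k 1≤k k≤i with ≤-suc-cases k≤i
    ... | inj₂ refl = ⇔.trans (proj₁ (pending-top same-refl)) Ci-correct ,
                      ⇔.trans (proj₂ (pending-top same-refl)) Vi-correct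
    ... | inj₁ k≤p = ⇔.trans (proj₁ (pending-below same-refl 1≤k k≤p)) (undropped-cumulative ¬dropped k≤p) ,
                     ⇔.trans (proj₂ (pending-below same-refl 1≤k k≤p)) (undropped-volatile ¬dropped k≤p)

    -- Once a dropped clause d is found in C_k, it is in no C_{k'} any more:
    -- at k it was removed, at i it never was (d ∈ F_p), and elsewhere it
    -- would be cumulative at a second index.
    found-removed : ∀ {s d k} → Dropped p d → Same s s′ d → 1 ≤ k → k ≤ p → d ∈ C s k →
      ∀ k′ → 1 ≤ k′ → k′ ≤ i → d ∉ C (found d i k s) k′
    found-removed {s} {d} {k} (d∈Fp , _) s~s′ 1≤k k≤p d∈Ck k′ 1≤k′ k′≤i d∈ with toSum (k′ ℕ.≟ k)
    ... | inj₁ refl = proj₂ (to (∈-removeOne d (C s k)) (to (∈-upd-here (C s) k _) d∈)) refl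
    ... | inj₂ k′≢k with to (∈-upd-elsewhere (C s) k _ k′ k′≢k) d∈ | ≤-suc-cases k′≤i
    ...   | d∈Ck′ | inj₂ refl =
            proj₂ (to (∈-∖ (F i) (F p)) (proj₁ (to (∈-∖ _ Vi) (to (proj₁ (pending-top s~s′)) d∈Ck′)))) d∈Fp
    ...   | d∈Ck′ | inj₁ k′≤p =
            k′≢k (cumulative-unique 1≤k′ 1≤k (m≤n⇒m≤1+n k′≤p) (m≤n⇒m≤1+n k≤p)
                    (to (proj₁ (pending-below s~s′ 1≤k′ k′≤p)) d∈Ck′)
                    (to (proj₁ (pending-below s~s′ 1≤k k≤p)) d∈Ck))

    -- After being found, d is in V_{k'} exactly when it occurs in F_{k'}: from k to p
    -- it was added, at i it is in V_i, and before k it was already volatile.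
    found-volatile : ∀ {s d k} → Dropped p d → Same s s′ d → 1 ≤ k → k ≤ p →
      Cumulative (suc p) F k d →
      ∀ k′ → 1 ≤ k′ → k′ ≤ i → d ∈ V (found d i k s) k′ ⇔ d ∈ F k′
    found-volatile {s} {d} {k} (_ , _ , d∉Fi+1) s~s′ 1≤k k≤p cum-k k′ 1≤k′ k′≤i
      with toSum ((k ≤? k′) ×-dec (k′ ≤? p))
    ... | inj₁ (k≤k′ , k′≤p) =
          mk⇔ (λ _ → cumulative-persists cum-k k≤k′ (m≤n⇒m≤1+n k′≤p))
              (λ _ → from (∈-addV-inside d k i (V s) k′ k≤k′ k′≤p) (inj₂ refl))
    ... | inj₂ out with ≤-suc-cases k′≤i
    ...   | inj₂ refl = ⇔.trans (∈-addV-outside d k i (V s) i out)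
                          (⇔.trans (proj₂ (pending-top s~s′))
                            (mk⇔ (λ d∈Vi → proj₁ (to (∈-∖ (F i) _) d∈Vi)) (λ d∈Fi → from (∈-∖ (F i) _) (d∈Fi , d∉Fi+1))))
    ...   | inj₁ k′≤p = ⇔.trans (∈-addV-outside d k i (V s) k′ out)
                          (⇔.trans (proj₂ (pending-below s~s′ 1≤k′ k′≤p)) (mk⇔ proj₁ earlier))
      where
      k′<k : k′ < k
      k′<k = ≰⇒> (λ k≤k′ → out (k≤k′ , k′≤p))
      earlier : d ∈ F k′ → Volatile (suc p) F k′ d
      earlier d∈Fk′ with proj₁ (proj₂ cum-k)
      ... | inj₁ refl = ⊥-elim (<⇒≱ k′<k 1≤k′)
      ... | inj₂ d∉ = volatile-before-gap k′<k (m≤n⇒m≤1+n k≤p) d∉ d∈Fk′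

    -- Processing a pending dropped clause records it correctly: the loop
    -- must find it, at the start of its last run.
    process-dropped : ∀ {s d} → Dropped p d → Same s s′ d → Agrees i (jloop d i 1 p s) d
    process-dropped {s} {d} dropped@(d∈Fp , d∈Fi , _) s~s′
      with cumulative-start q d∈Fp | jloop d i 1 p s | jloop-outcome d i 1 p s
    ... | k₀ , 1≤k₀ , k₀≤p , cum₀ | _ | missed none =
          ⊥-elim (none k₀ 1≤k₀ (s≤s k₀≤p) (from (proj₁ (pending-below s~s′ 1≤k₀ k₀≤p)) (cumulative-extend cum₀ d∈Fi)))
    ... | _ | _ | found-at k 1≤k k<1+p d∈Ck = λ k′ 1≤k′ k′≤i →
          mk⇔ (λ d∈ → ⊥-elim (found-removed dropped s~s′ 1≤k (≤-pred k<1+p) d∈Ck k′ 1≤k′ k′≤i d∈))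
              (λ cum → ⊥-elim (dropped-not-cumulative dropped k′≤i cum)) ,
          ⇔.trans (found-volatile dropped s~s′ 1≤k (≤-pred k<1+p)
                    (to (proj₁ (pending-below s~s′ 1≤k (≤-pred k<1+p))) d∈Ck) k′ 1≤k′ k′≤i)
                  (⇔.sym (dropped-volatile dropped k′≤i))

    process-settled : ∀ {s d} → Dropped p d → Agrees i s d → jloop d i 1 p s ≡ s
    process-settled {s} {d} dropped ag with jloop d i 1 p s | jloop-outcome d i 1 p s
    ... | _ | missed _ = refl
    ... | _ | found-at k 1≤k k<1+p d∈Ck =
          ⊥-elim (dropped-not-cumulative dropped k≤i (to (proj₁ (ag k 1≤k k≤i)) d∈Ck))
      where
      k≤i : k ≤ i
      k≤i = m≤n⇒m≤1+n (≤-pred k<1+p)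

    process-all : ∀ R s → (∀ d → d ∈ R → Dropped p d) →
      (∀ d → Agrees i s d ⊎ (d ∈ R × Same s s′ d)) → Correct i (foldl (processClause i) s R)
    process-all [] s _ status d with status d
    ... | inj₁ ag = ag
    ... | inj₂ (() , _)
    process-all (c ∷ R) s R-dropped status =
      process-all R (jloop c i 1 p s) (λ d d∈R → R-dropped d (there d∈R)) status′
      where
      status′ : ∀ d → Agrees i (jloop c i 1 p s) d ⊎ (d ∈ R × Same (jloop c i 1 p s) s′ d)
      status′ d with d ≟ c | status d
      ... | yes refl | inj₁ ag = inj₁ (subst (λ t → Agrees i t d) (sym (process-settled (R-dropped d (here refl)) ag)) ag)
      ... | yes refl | inj₂ (_ , s~s′) = inj₁ (process-dropped (R-dropped d (here refl)) s~s′)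
      ... | no d≢c | inj₁ ag = inj₁ (agrees-transfer (jloop-other c i 1 p s d≢c) ag)
      ... | no d≢c | inj₂ (here d≡c , _) = ⊥-elim (d≢c d≡c)
      ... | no d≢c | inj₂ (there d∈R , s~s′) = inj₂ (d∈R , same-trans (jloop-other c i 1 p s d≢c) s~s′)

    iteration-correct : Correct i (step2 F i s₀)
    iteration-correct = process-all L s′ (λ d d∈L → to ∈L⇔dropped d∈L) status
      where
      status : ∀ d → Agrees i s′ d ⊎ (d ∈ L × Same s′ s′ d)
      status d with d ∈? L
      ... | yes d∈L = inj₂ (d∈L , same-refl)
      ... | no d∉L = inj₁ (undropped-agrees (λ dropped → d∉L (from ∈L⇔dropped dropped)))

  outer-correct : ∀ fuel q s → Correct (suc q) s → Correct (suc q + fuel) (outer F (suc (suc q)) fuel s)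
  outer-correct zero q s correct = subst (λ m → Correct m s) (sym (+-identityʳ (suc q))) correct
  outer-correct (suc fuel) q s correct =
    subst (λ m → Correct m (outer F (suc (suc q)) (suc fuel) s)) (sym (+-suc (suc q) fuel))
      (outer-correct fuel (suc q) (step2 F (suc (suc q)) s) (Iteration.iteration-correct q s correct))

  last-cumulative : ∀ q {d} → d ∈ F (suc (suc q)) ∖ F (suc q) ⇔ Cumulative (suc (suc q)) F (suc (suc q)) d
  last-cumulative q = mk⇔
    (λ d∈ → let (d∈Fn , d∉) = to (∈-∖ _ (F (suc q))) d∈ in d∈Fn , inj₂ d∉ , nothing-after (suc (suc q)))
    (λ { (d∈Fn , inj₂ d∉ , _) → from (∈-∖ _ (F (suc q))) (d∈Fn , d∉) })

  last-volatile : ∀ n {d} → d ∈ [] ⇔ Volatile n F n d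
  last-volatile n = mk⇔ (λ ()) (λ (_ , j , n<j , j≤n , _) → nothing-after n j n<j j≤n)

  procedure-correct : ∀ q i d → 1 ≤ i → i ≤ suc (suc q) →
    (d ∈ C (procedure (suc (suc q)) F) i ⇔ Cumulative (suc (suc q)) F i d) ×
    (d ∈ V (procedure (suc (suc q)) F) i ⇔ Volatile (suc (suc q)) F i d)
  procedure-correct q i d 1≤i i≤n with ≤-suc-cases i≤n
  ... | inj₂ refl = ⇔.trans (∈-upd-here (C s₂) i _) (last-cumulative q) ,
                    ⇔.trans (∈-upd-here (V s₂) i _) (last-volatile i)
    where
    s₂ = outer F 2 q initial
  ... | inj₁ i≤n-1 =
        ⇔.trans (∈-upd-elsewhere (C s₂) (suc (suc q)) _ i i≢n) (proj₁ (s₂-correct d i 1≤i i≤n-1)) ,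
        ⇔.trans (∈-upd-elsewhere (V s₂) (suc (suc q)) _ i i≢n) (proj₂ (s₂-correct d i 1≤i i≤n-1))
    where
    s₂ = outer F 2 q initial
    s₂-correct : Correct (suc q) s₂
    s₂-correct = outer-correct q 0 initial initial-correct
    i≢n : i ≢ suc (suc q)
    i≢n refl = <⇒≱ ≤-refl i≤n-1

theorem1 : {A : Set} (_≟_ : DecidableEquality A) (n : ℕ) → 2 ≤ n →
    (F : ℕ → List A) → (i : ℕ) → 1 ≤ i → i ≤ n → (c : A) →
    (c ∈ Proc.C (Proc.procedure _≟_ n F) i ⇔ Cumulative n F i c) ×
    (c ∈ Proc.V (Proc.procedure _≟_ n F) i ⇔ Volatile n F i c)
theorem1 _≟_ (suc zero) (s≤s ()) F i 1≤i i≤n c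
theorem1 _≟_ (suc (suc q)) _ F i 1≤i i≤n c = Correctness.procedure-correct _≟_ F q i c 1≤i i≤n
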